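{- Let $r,k\ge 2$ and $n\ge r-1$ be integers, and let $\mathcal{A}_0\subset\{0,1\}^n$ be a set of initially infected vertices of $Q_{n,k}$. If $\mathcal{A}_0$ contains an $(r-1)$-dimensional subcube of $\{0,1\}^n$ (i.e., a set of the form $\{x\in\{0,1\}^n: x_j=b_j \text{ for all } j\notin S\}$ with $|S|=r-1$ and fixed bits $b_j$), then the $r$-neighbor bootstrap percolation process on $Q_{n,k}$ started from $\mathcal{A}_0$ percolates.
   Context: For integers $n\ge1$, $k\ge1$, $Q_{n,k}$ denotes the graph with vertex set $\{0,1\}^n$ in which two vertices $x,y$ are adjacent iff $1\le d_H(x,y)\le k$, where $d_H$ is the Hamming distance. For a vertex $v$, $N_v$ is its neighborhood in $Q_{n,k}$. The $r$-neighbor bootstrap percolation process started from $\mathcal{A}_0\subset V$ is defined by $\mathcal{A}_i=\mathcal{A}_{i-1}\cup\{v\in V: |N_v\cap\mathcal{A}_{i-1}|\ge r\}$ for $i\ge1$; the process percolates (and $\mathcal{A}_0$ is called contagious) if $\mathcal{A}_i=V$ for some $i$. -}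

module Defs where

open import Data.Bool using (Bool; true; false; _∨_; _∧_; if_then_else_)
open import Data.Nat using (ℕ; zero; suc; _+_; _≤ᵇ_)
open import Data.Vec using (Vec; []; _∷_; lookup)
open import Data.Fin using (Fin)
open import Data.List using (List; []; _∷_; map; _++_; length; filter)
open import Relation.Binary.PropositionalEquality using (_≡_)

Vertex : ℕ → Set
Vertex n = Vec Bool n

allVertices : (n : ℕ) → List (Vertex n)
allVertices zero = [] ∷ []
allVertices (suc n) = map (false ∷_) (allVertices n) ++ map (true ∷_) (allVertices n)

xorB : Bool → Bool → Bool
xorB true  b = if b then false else true
xorB false b = b

hamming : {n : ℕ} → Vertex n → Vertex n → ℕ
hamming []       []       = 0
hamming (a ∷ x) (b ∷ y) = (if xorB a b then 1 else 0) + hamming x y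

adjacent : {n : ℕ} → (k : ℕ) → Vertex n → Vertex n → Bool
adjacent k x y = (1 ≤ᵇ hamming x y) ∧ (hamming x y ≤ᵇ k)

VSet : ℕ → Set
VSet n = Vertex n → Bool

nbrCount : {n : ℕ} → (k : ℕ) → VSet n → Vertex n → ℕ
nbrCount {n} k A v = length (filter (λ u → (adjacent k v u ∧ A u) Data.Bool.≟ true) (allVertices n))
  where import Data.Bool

stage : {n : ℕ} → (k r : ℕ) → VSet n → ℕ → VSet n
stage k r A zero    v = A v
stage k r A (suc i) v = stage k r A i v ∨ (r ≤ᵇ nbrCount k (stage k r A i) v)

Percolates : (n k r : ℕ) → VSet n → Set
Percolates n k r A = Σ ℕ (λ i → (v : Vertex n) → stage k r A i v ≡ true)
  where open import Data.Product using (Σ)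

-- Number of true entries of a coordinate set S ⊆ [n].
card : {n : ℕ} → Vec Bool n → ℕ
card []          = 0
card (true ∷ s)  = suc (card s)
card (false ∷ s) = card s

ContainsSubcube : {n : ℕ} → VSet n → Vec Bool n → Vertex n → Set
ContainsSubcube {n} A S b =
  (x : Vertex n) → ((j : Fin n) → lookup S j ≡ false → lookup x j ≡ lookup b j) → A x ≡ true

ContainsSubcubeOfDim : {n : ℕ} → ℕ → VSet n → Set
ContainsSubcubeOfDim {n} d A =
  Σ (Vec Bool n) (λ S → Σ (Vertex n) (λ b → card S ≡ d × ContainsSubcube A S b))
  where open import Data.Product using (Σ; _×_)

{-# OPTIONS --safe #-}
-- Let d(x) be the Hamming distance from x to the subcube C = {y : y_j = b_j for j ∉ S},
-- i.e. the number of coordinates j ∉ S with x_j ≠ b_j. By induction on m, every x with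
-- d(x) ≤ m is infected at time m. If d(x) = m + 1, flip a coordinate j ∉ S where x and b
-- differ to get z with d(z) = m. Then z together with the |S| = r - 1 vertices obtained
-- from z by flipping one coordinate of S all have distance m to C, so they are infected
-- at time m, and they lie at Hamming distance 1 or 2 ≤ k from x. That gives x at least
-- r infected neighbours.
module Submission where

open import Defs
open import Data.Bool using (Bool; true; false; not; _∧_; _∨_; if_then_else_)
import Data.Bool as Bool
open import Data.Bool.Properties using (T-≡; T-∧; ∨-zeroʳ)
open import Data.Nat using (ℕ; zero; suc; _+_; _≤_; _∸_; z≤n; s≤s)
open import Data.Nat.Properties
open import Data.Vec using (Vec; []; _∷_; lookup)
open import Data.Fin using (Fin; zero; suc)
open import Data.List using (List; []; _∷_; map; _++_; length; filter)
open import Data.List.Properties using (filter-++; length-++)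
open import Data.Product using (Σ; _×_; _,_)
open import Data.Sum using (inj₁; inj₂)
open import Function using (_∘_)
open import Function.Bundles using (Equivalence)
open import Relation.Binary.PropositionalEquality
open import Relation.Nullary using (contradiction)

open Equivalence using (to; from)

countᵇ : {A : Set} → (A → Bool) → List A → ℕ
countᵇ P xs = length (filter (λ x → P x Bool.≟ true) xs)

countᵇ-++ : {A : Set} (P : A → Bool) (xs ys : List A) →
  countᵇ P (xs ++ ys) ≡ countᵇ P xs + countᵇ P ys
countᵇ-++ P xs ys = trans (cong length (filter-++ _ xs ys)) (length-++ (filter _ xs))

countᵇ-map : {A B : Set} (P : B → Bool) (f : A → B) (xs : List A) →
  countᵇ P (map f xs) ≡ countᵇ (P ∘ f) xs
countᵇ-map P f []       = refl
countᵇ-map P f (x ∷ xs) with P (f x)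
... | true  = cong suc (countᵇ-map P f xs)
... | false = countᵇ-map P f xs

count : (n : ℕ) → VSet n → ℕ
count n P = countᵇ P (allVertices n)

count-suc : ∀ {n} (P : VSet (suc n)) →
  count (suc n) P ≡ count n (P ∘ (false ∷_)) + count n (P ∘ (true ∷_))
count-suc {n} P = begin
  countᵇ P (map (false ∷_) (allVertices n) ++ map (true ∷_) (allVertices n))
    ≡⟨ countᵇ-++ P (map (false ∷_) (allVertices n)) (map (true ∷_) (allVertices n)) ⟩
  countᵇ P (map (false ∷_) (allVertices n)) + countᵇ P (map (true ∷_) (allVertices n))
    ≡⟨ cong₂ _+_ (countᵇ-map P _ (allVertices n)) (countᵇ-map P _ (allVertices n)) ⟩
  count n (P ∘ (false ∷_)) + count n (P ∘ (true ∷_))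
    ∎
  where open ≡-Reasoning

count-split : ∀ {n} (P : VSet (suc n)) a →
  count (suc n) P ≡ count n (P ∘ (not a ∷_)) + count n (P ∘ (a ∷_))
count-split {n} P false =
  trans (count-suc P) (+-comm (count n (P ∘ (false ∷_))) (count n (P ∘ (true ∷_))))
count-split P true  = count-suc P

count-pos : ∀ n (P : VSet n) z → P z ≡ true → 1 ≤ count n P
count-pos zero    P []      Pz rewrite Pz = s≤s z≤n
count-pos (suc n) P (a ∷ z) Pz rewrite count-split P a =
  ≤-trans (count-pos n (P ∘ (a ∷_)) z Pz) (m≤n+m _ _)

flipBit : ∀ {n} → Fin n → Vertex n → Vertex n
flipBit zero    (a ∷ x) = not a ∷ x
flipBit (suc j) (a ∷ x) = a ∷ flipBit j x

star≤count : ∀ n (P : VSet n) z (S : Vec Bool n) → P z ≡ true →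
  (∀ s → lookup S s ≡ true → P (flipBit s z) ≡ true) → suc (card S) ≤ count n P
star≤count zero    P []      []          Pz PS = count-pos zero P [] Pz
star≤count (suc n) P (a ∷ z) (true ∷ S)  Pz PS rewrite count-split P a =
  +-mono-≤ (count-pos n _ z (PS zero refl)) (star≤count n _ z S Pz (PS ∘ suc))
star≤count (suc n) P (a ∷ z) (false ∷ S) Pz PS rewrite count-split P a =
  ≤-trans (star≤count n _ z S Pz (PS ∘ suc)) (m≤n+m _ _)

bitDist : Bool → Bool → ℕ
bitDist a b = if xorB a b then 1 else 0

bitDist-self : ∀ a → bitDist a a ≡ 0
bitDist-self true  = refl
bitDist-self false = refl

bitDist-not : ∀ a → bitDist a (not a) ≡ 1
bitDist-not true  = refl
bitDist-not false = refl

bitDist≤1 : ∀ a b → bitDist a b ≤ 1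
bitDist≤1 true  true  = z≤n
bitDist≤1 true  false = s≤s z≤n
bitDist≤1 false true  = s≤s z≤n
bitDist≤1 false false = z≤n

bitDist≡0⇒≡ : ∀ a b → bitDist a b ≡ 0 → b ≡ a
bitDist≡0⇒≡ true  true  _ = refl
bitDist≡0⇒≡ false false _ = refl

hamming-self : ∀ {n} (x : Vertex n) → hamming x x ≡ 0
hamming-self []      = refl
hamming-self (a ∷ x) = cong₂ _+_ (bitDist-self a) (hamming-self x)

hamming-flipBit : ∀ {n} (j : Fin n) (x : Vertex n) → hamming x (flipBit j x) ≡ 1
hamming-flipBit zero    (a ∷ x) = cong₂ _+_ (bitDist-not a) (hamming-self x)
hamming-flipBit (suc j) (a ∷ x) = cong₂ _+_ (bitDist-self a) (hamming-flipBit j x)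

hamming-flipBit² : ∀ {n} {s j : Fin n} (x : Vertex n) → s ≢ j →
  hamming x (flipBit s (flipBit j x)) ≡ 2
hamming-flipBit² {s = zero}  {zero}  x       s≢j = contradiction refl s≢j
hamming-flipBit² {s = zero}  {suc j} (a ∷ x) _   = cong₂ _+_ (bitDist-not a) (hamming-flipBit j x)
hamming-flipBit² {s = suc s} {zero}  (a ∷ x) _   = cong₂ _+_ (bitDist-not a) (hamming-flipBit s x)
hamming-flipBit² {s = suc s} {suc j} (a ∷ x) s≢j =
  cong₂ _+_ (bitDist-self a) (hamming-flipBit² x (s≢j ∘ cong suc))

adjacent-intro : ∀ {n k d} (x y : Vertex n) → hamming x y ≡ d → 1 ≤ d → d ≤ k →
  adjacent k x y ≡ true
adjacent-intro x y refl 1≤d d≤k = to T-≡ (from T-∧ (≤⇒≤ᵇ 1≤d , ≤⇒≤ᵇ d≤k))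

distToSubcube : ∀ {n} → Vec Bool n → Vertex n → Vertex n → ℕ
distToSubcube []          []      []      = 0
distToSubcube (true ∷ S)  (_ ∷ b) (_ ∷ x) = distToSubcube S b x
distToSubcube (false ∷ S) (c ∷ b) (a ∷ x) = bitDist c a + distToSubcube S b x

distToSubcube≤n : ∀ {n} (S b x : Vec Bool n) → distToSubcube S b x ≤ n
distToSubcube≤n []          []      []      = z≤n
distToSubcube≤n (true ∷ S)  (_ ∷ b) (_ ∷ x) = m≤n⇒m≤1+n (distToSubcube≤n S b x)
distToSubcube≤n (false ∷ S) (c ∷ b) (a ∷ x) = +-mono-≤ (bitDist≤1 c a) (distToSubcube≤n S b x)

distToSubcube≡0⇒∈ : ∀ {n} (S b x : Vec Bool n) → distToSubcube S b x ≡ 0 →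
  ∀ j → lookup S j ≡ false → lookup x j ≡ lookup b j
distToSubcube≡0⇒∈ (true ∷ S)  (_ ∷ b) (_ ∷ x) d≡0 (suc j) j∉S =
  distToSubcube≡0⇒∈ S b x d≡0 j j∉S
distToSubcube≡0⇒∈ (false ∷ S) (c ∷ b) (a ∷ x) d≡0 zero    _   =
  bitDist≡0⇒≡ c a (m+n≡0⇒m≡0 (bitDist c a) d≡0)
distToSubcube≡0⇒∈ (false ∷ S) (c ∷ b) (a ∷ x) d≡0 (suc j) j∉S =
  distToSubcube≡0⇒∈ S b x (m+n≡0⇒n≡0 (bitDist c a) d≡0) j j∉S

distToSubcube-flipBit : ∀ {n} (S b x : Vec Bool n) {s} → lookup S s ≡ true →
  distToSubcube S b (flipBit s x) ≡ distToSubcube S b x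
distToSubcube-flipBit (true ∷ S)  (_ ∷ b) (_ ∷ x) {zero}  _   = refl
distToSubcube-flipBit (true ∷ S)  (_ ∷ b) (_ ∷ x) {suc s} s∈S = distToSubcube-flipBit S b x s∈S
distToSubcube-flipBit (false ∷ S) (c ∷ b) (a ∷ x) {suc s} s∈S =
  cong (bitDist c a +_) (distToSubcube-flipBit S b x s∈S)

distToSubcube-suc : ∀ {n m} (S b x : Vec Bool n) → distToSubcube S b x ≡ suc m →
  Σ (Fin n) λ j → lookup S j ≡ false × distToSubcube S b (flipBit j x) ≡ m
distToSubcube-suc [] [] [] ()
distToSubcube-suc (true ∷ S) (_ ∷ b) (_ ∷ x) d≡1+m with distToSubcube-suc S b x d≡1+m
... | j , j∉S , d′≡m = suc j , j∉S , d′≡m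
distToSubcube-suc (false ∷ S) (false ∷ b) (true ∷ x)  d≡1+m = zero , refl , suc-injective d≡1+m
distToSubcube-suc (false ∷ S) (true ∷ b)  (false ∷ x) d≡1+m = zero , refl , suc-injective d≡1+m
distToSubcube-suc (false ∷ S) (false ∷ b) (false ∷ x) d≡1+m with distToSubcube-suc S b x d≡1+m
... | j , j∉S , d′≡m = suc j , j∉S , d′≡m
distToSubcube-suc (false ∷ S) (true ∷ b)  (true ∷ x)  d≡1+m with distToSubcube-suc S b x d≡1+m
... | j , j∉S , d′≡m = suc j , j∉S , d′≡m

module _ {k r n : ℕ} {A₀ : VSet n} where

  stage-⊆-suc : ∀ i v → stage k r A₀ i v ≡ true → stage k r A₀ (suc i) v ≡ true
  stage-⊆-suc i v v∈Aᵢ rewrite v∈Aᵢ = refl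

  stage-suc-threshold : ∀ i v → r ≤ nbrCount k (stage k r A₀ i) v →
    stage k r A₀ (suc i) v ≡ true
  stage-suc-threshold i v r≤N =
    trans (cong (stage k r A₀ i v ∨_) (to T-≡ (≤⇒≤ᵇ r≤N))) (∨-zeroʳ (stage k r A₀ i v))

module _ {k r n : ℕ} (2≤k : 2 ≤ k) {A₀ : VSet n} (S b : Vec Bool n)
         (r≤1+|S| : r ≤ suc (card S)) (A₀⊇C : ContainsSubcube A₀ S b) where

  near-subcube⇒infected : ∀ m x → distToSubcube S b x ≤ m → stage k r A₀ m x ≡ true
  near-subcube⇒infected zero x d≤0 = A₀⊇C x (distToSubcube≡0⇒∈ S b x (n≤0⇒n≡0 d≤0))
  near-subcube⇒infected (suc m) x d≤1+m with m≤n⇒m<n∨m≡n d≤1+m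
  ... | inj₁ d<1+m = stage-⊆-suc m x (near-subcube⇒infected m x (≤-pred d<1+m))
  ... | inj₂ d≡1+m with distToSubcube-suc S b x d≡1+m
  ...   | j , j∉S , dz≡m =
    stage-suc-threshold m x (≤-trans r≤1+|S| (star≤count n P z S Pz PS))
    where
      z : Vertex n
      z = flipBit j x

      P : VSet n
      P u = adjacent k x u ∧ stage k r A₀ m u

      infected-neighbour : ∀ {d} u → hamming x u ≡ d → 1 ≤ d → d ≤ 2 →
        distToSubcube S b u ≡ m → P u ≡ true
      infected-neighbour u xu≡d 1≤d d≤2 du≡m
        rewrite adjacent-intro x u xu≡d 1≤d (≤-trans d≤2 2≤k) =
        near-subcube⇒infected m u (≤-reflexive du≡m)

      Pz : P z ≡ true
      Pz = infected-neighbour z (hamming-flipBit j x) ≤-refl (s≤s z≤n) dz≡m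

      PS : ∀ s → lookup S s ≡ true → P (flipBit s z) ≡ true
      PS s s∈S = infected-neighbour (flipBit s z) (hamming-flipBit² x s≢j) (s≤s z≤n) ≤-refl
        (trans (distToSubcube-flipBit S b z s∈S) dz≡m)
        where
          s≢j : s ≢ j
          s≢j refl with trans (sym s∈S) j∉S
          ... | ()

lemma2p1 : (r k n : ℕ) → 2 ≤ r → 2 ≤ k → r ∸ 1 ≤ n →
    (A₀ : VSet n) → ContainsSubcubeOfDim (r ∸ 1) A₀ → Percolates n k r A₀
lemma2p1 r k n (s≤s (s≤s _)) 2≤k _ A₀ (S , b , |S|≡r-1 , A₀⊇C) =
  n , λ v → near-subcube⇒infected 2≤k S b r≤1+|S| A₀⊇C n v (distToSubcube≤n S b v)
  where
    r≤1+|S| : r ≤ suc (card S)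
    r≤1+|S| = ≤-reflexive (cong suc (sym |S|≡r-1))
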